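{- Let $E$ be a simple finite-dimensional $\mathbf{Q}$-algebra, let $m,k\ge1$ be integers, let $\sigma$ be an automorphism of $E$ with $\sigma^m=1$, and let $f$ be the automorphism of $E^k$ given by $f(x_1,\dots,x_k)=(\sigma(x_k),x_1,\dots,x_{k-1})$. Then $E^k[mk,f]\simeq\mathrm{M}_k(E[m,\sigma])$.
   Context: For a finite-dimensional $\mathbf{Q}$-algebra $R$, an integer $N\ge1$ and an automorphism $\phi$ of $R$ with $\phi^N=1$, $R[N,\phi]$ denotes the $\mathbf{Q}$-algebra $\bigoplus_{i=0}^{N-1}R\,u^i$ with multiplication determined by $u^N=1$ and $ux=\phi(x)u$ for $x\in R$. -}

module Defs where

open import Level using (Level; _⊔_)
open import Data.Nat as ℕ using (ℕ; zero; suc)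
open import Data.Fin using (Fin; zero; suc; toℕ; fromℕ; inject₁)
open import Data.Bool using (Bool; true; false; if_then_else_; _∨_)
open import Data.Product using (Σ; _×_; _,_)
open import Data.Sum using (_⊎_)
open import Relation.Nullary using (¬_; does)
open import Relation.Binary.PropositionalEquality using (_≡_)
open import Data.Rational as ℚ using (ℚ)
open import Algebra.Structures using (IsRing)

iter : ∀ {a} {A : Set a} → ℕ → (A → A) → A → A
iter zero    f x = x
iter (suc n) f x = f (iter n f x)

record QAlgebra (c ℓ : Level) : Set (Level.suc (c ⊔ ℓ)) where
  infixl 7 _*_
  infixl 6 _+_
  infixr 7 _·_
  infix  4 _≈_
  field
    Carrier : Set c
    _≈_     : Carrier → Carrier → Set ℓ
    _+_     : Carrier → Carrier → Carrier
    _*_     : Carrier → Carrier → Carrier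
    -_      : Carrier → Carrier
    0#      : Carrier
    1#      : Carrier
    _·_     : ℚ → Carrier → Carrier
    isRing  : IsRing _≈_ _+_ _*_ -_ 0# 1#
    ·-cong    : ∀ a {x y} → x ≈ y → a · x ≈ a · y
    ·-distribˡ : ∀ a x y → a · (x + y) ≈ a · x + a · y
    ·-distribʳ : ∀ a b x → (a ℚ.+ b) · x ≈ a · x + b · x
    ·-assoc   : ∀ a b x → (a ℚ.* b) · x ≈ a · (b · x)
    ·-identity : ∀ x → ℚ.1ℚ · x ≈ x
    ·-*-assocˡ : ∀ a x y → (a · x) * y ≈ a · (x * y)
    ·-*-assocʳ : ∀ a x y → x * (a · y) ≈ a · (x * y)

module _ {c ℓ} (A : QAlgebra c ℓ) where
  open QAlgebra A

  sumA : ∀ {n} → (Fin n → Carrier) → Carrier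
  sumA {zero}  v = 0#
  sumA {suc n} v = v zero + sumA (λ i → v (suc i))

  FiniteDimensional : Set (c ⊔ ℓ)
  FiniteDimensional =
    Σ ℕ λ n → Σ (Fin n → Carrier) λ b →
      ∀ x → Σ (Fin n → ℚ) λ λs → x ≈ sumA (λ i → λs i · b i)

  record IsTwoSidedIdeal {p} (I : Carrier → Set p) : Set (c ⊔ ℓ ⊔ p) where
    field
      resp  : ∀ {x y} → x ≈ y → I x → I y
      zero∈ : I 0#
      +∈    : ∀ {x y} → I x → I y → I (x + y)
      ·∈    : ∀ a {x} → I x → I (a · x)
      *ˡ∈   : ∀ y {x} → I x → I (y * x)
      *ʳ∈   : ∀ y {x} → I x → I (x * y)

  IsSimple : ∀ p → Set (c ⊔ ℓ ⊔ Level.suc p)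
  IsSimple p = (¬ (1# ≈ 0#)) ×
    (∀ (I : Carrier → Set p) → IsTwoSidedIdeal I →
       (∀ x → I x → x ≈ 0#) ⊎ (∀ x → I x))

record Automorphism {c ℓ} (A : QAlgebra c ℓ) : Set (c ⊔ ℓ) where
  open QAlgebra A
  field
    to       : Carrier → Carrier
    from     : Carrier → Carrier
    to-cong  : ∀ {x y} → x ≈ y → to x ≈ to y
    from-cong : ∀ {x y} → x ≈ y → from x ≈ from y
    to-from  : ∀ x → to (from x) ≈ x
    from-to  : ∀ x → from (to x) ≈ x
    to-+     : ∀ x y → to (x + y) ≈ to x + to y
    to-*     : ∀ x y → to (x * y) ≈ to x * to y
    to-1     : to 1# ≈ 1#
    to-·     : ∀ a x → to (a · x) ≈ a · to x

-- Raw algebra signatures, used for the constructed algebras E^k,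
-- R[N,φ] and M_k(R): the operations are given explicitly.

record RawQAlg (c ℓ : Level) : Set (Level.suc (c ⊔ ℓ)) where
  field
    Carrier : Set c
    _≈_     : Carrier → Carrier → Set ℓ
    _+_     : Carrier → Carrier → Carrier
    _*_     : Carrier → Carrier → Carrier
    0#      : Carrier
    1#      : Carrier
    _·_     : ℚ → Carrier → Carrier

raw : ∀ {c ℓ} → QAlgebra c ℓ → RawQAlg c ℓ
raw A = record { QAlgebra A }

module _ {c ℓ} (R : RawQAlg c ℓ) where
  open RawQAlg R

  sumR : ∀ {n} → (Fin n → Carrier) → Carrier
  sumR {zero}  v = 0#
  sumR {suc n} v = v zero + sumR (λ i → v (suc i))

  powRaw : ℕ → RawQAlg c ℓ
  powRaw k = record
    { Carrier = Fin k → Carrier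
    ; _≈_ = λ x y → ∀ i → x i ≈ y i
    ; _+_ = λ x y i → x i + y i
    ; _*_ = λ x y i → x i * y i
    ; 0# = λ _ → 0#
    ; 1# = λ _ → 1#
    ; _·_ = λ a x i → a · x i
    }

  -- R[N,φ] = ⊕_{i<N} R u^i, u^N = 1, u x = φ(x) u.
  -- An element is its coefficient vector (x_i)_{i<N}, meaning Σ x_i u^i.
  -- (x_i u^i)(y_j u^j) = x_i φ^i(y_j) u^{(i+j) mod N}.
  twistRaw : (N : ℕ) → (Carrier → Carrier) → RawQAlg c ℓ
  twistRaw N φ = record
    { Carrier = Fin N → Carrier
    ; _≈_ = λ x y → ∀ i → x i ≈ y i
    ; _+_ = λ x y i → x i + y i
    ; _*_ = λ x y l → sumR (λ i → sumR (λ j →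
              if does (toℕ i ℕ.+ toℕ j ℕ.≟ toℕ l)
                 ∨ does (toℕ i ℕ.+ toℕ j ℕ.≟ toℕ l ℕ.+ N)
              then x i * iter (toℕ i) φ (y j)
              else 0#))
    ; 0# = λ _ → 0#
    ; 1# = λ i → if does (toℕ i ℕ.≟ 0) then 1# else 0#
    ; _·_ = λ a x i → a · x i
    }

  matRaw : ℕ → RawQAlg c ℓ
  matRaw k = record
    { Carrier = Fin k → Fin k → Carrier
    ; _≈_ = λ x y → ∀ i j → x i j ≈ y i j
    ; _+_ = λ x y i j → x i j + y i j
    ; _*_ = λ x y i j → sumR (λ l → x i l * y l j)
    ; 0# = λ _ _ → 0#
    ; 1# = λ i j → if does (toℕ i ℕ.≟ toℕ j) then 1# else 0#
    ; _·_ = λ a x i j → a · x i j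
    }

record _≃Alg_ {c₁ ℓ₁ c₂ ℓ₂} (A : RawQAlg c₁ ℓ₁) (B : RawQAlg c₂ ℓ₂)
       : Set (c₁ ⊔ ℓ₁ ⊔ c₂ ⊔ ℓ₂) where
  module A = RawQAlg A
  module B = RawQAlg B
  field
    to        : A.Carrier → B.Carrier
    from      : B.Carrier → A.Carrier
    to-cong   : ∀ {x y} → x A.≈ y → to x B.≈ to y
    from-cong : ∀ {x y} → x B.≈ y → from x A.≈ from y
    to-from   : ∀ y → to (from y) B.≈ y
    from-to   : ∀ x → from (to x) A.≈ x
    to-+      : ∀ x y → to (x A.+ y) B.≈ (to x B.+ to y)
    to-*      : ∀ x y → to (x A.* y) B.≈ (to x B.* to y)
    to-1      : to A.1# B.≈ B.1#
    to-·      : ∀ a x → to (a A.· x) B.≈ (a B.· to x)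

-- The automorphism f(x_1,…,x_k) = (σ(x_k), x_1, …, x_{k-1}) of E^k
-- (components indexed 0,…,k-1).

cycShift : ∀ {a} {E : Set a} (σ : E → E) (k : ℕ) → (Fin k → E) → (Fin k → E)
cycShift σ zero    x i       = x i
cycShift σ (suc k) x zero    = σ (x (fromℕ k))
cycShift σ (suc k) x (suc i) = x (inject₁ i)

{-# OPTIONS --safe #-}
module Submission where

-- Write u for the generator of E^k[mk, f] and v for that of E[m, σ]. As f moves
-- coordinate c to c + 1 and applies σ on wrapping around, the a-th coordinate of
-- f^i(y) is σ^q(y_c) whenever i + c = a + q k. So X = Σ_i X_i u^i is sent to the
-- matrix whose (a, c) entry is Σ_s (X_{deg a c s})_a v^s, where deg a c s is the
-- residue of a - c + s k modulo mk. For fixed a, (c, s) ↦ deg a c s is a bijection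
-- onto Z/mk, and reindexing the convolution that defines the product of
-- E^k[mk, f] along it gives exactly the product of matrices over E[m, σ].

open import Defs
open import Algebra.Bundles using (Ring)
open import Algebra.Structures using (IsRing)
import Algebra.Properties.Semiring.Sum as SemiringSum
open import Data.Bool using (Bool; true; false; T; if_then_else_; _∨_; _∧_)
open import Data.Bool.Properties using (T-∨; if-float; if-∧)
open import Data.Fin using (Fin; zero; suc; toℕ; fromℕ; inject₁; opposite; combine; remQuot; _↑ˡ_; _↑ʳ_; punchIn)
open import Data.Fin.Permutation using (Permutation′; permutation; _⟨$⟩ˡ_; inverseˡ; inverseʳ)
open import Data.Fin.Properties
  using (toℕ-injective; toℕ<n; toℕ-fromℕ<; toℕ-fromℕ; toℕ-inject₁; toℕ-combine; opposite-prop;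
         opposite-involutive; remQuot-combine; *↔×; punchInᵢ≢i)
open import Data.Nat as ℕ
  using (ℕ; zero; suc; pred; _+_; _*_; _∸_; _≤_; _<_; _<?_; NonZero; >-nonZero; >-nonZero⁻¹)
open import Data.Nat.Properties
open import Data.Nat.DivMod
open import Data.Nat.Divisibility using (n∣m*n)
open import Data.Nat.Tactic.RingSolver using (solve-∀)
open import Data.Product using (_×_; _,_; ∃; uncurry)
open import Data.Product.Properties using (,-injective)
open import Data.Sum using (_⊎_; inj₁; inj₂)
open import Function using (_∘_; _↔_; _⇔_; Inverse; Injection; Equivalence; mk↔ₛ′; mk⇔)
open import Function.Construct.Composition using (_↔-∘_)
open import Function.Construct.Symmetry using (↔-sym)
open import Function.Properties.Inverse using (↔⇒↣)
open import Relation.Nullary using (¬_; yes; no; does; contradiction; _×-dec_)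
open import Relation.Nullary.Decidable using (does-⇔)
open import Relation.Binary.PropositionalEquality
  using (_≡_; _≢_; refl; sym; trans; cong; cong₂; module ≡-Reasoning)

module _ (n : ℕ) .{{_ : NonZero n}} where

  %-cong-+ : ∀ {x x′ y y′} → x % n ≡ x′ % n → y % n ≡ y′ % n → (x + y) % n ≡ (x′ + y′) % n
  %-cong-+ {x} {x′} {y} {y′} x≡x′ y≡y′ = begin
    (x + y) % n            ≡⟨ %-distribˡ-+ x y n ⟩
    (x % n + y % n) % n    ≡⟨ cong₂ (λ u v → (u + v) % n) x≡x′ y≡y′ ⟩
    (x′ % n + y′ % n) % n  ≡⟨ %-distribˡ-+ x′ y′ n ⟨
    (x′ + y′) % n          ∎
    where open ≡-Reasoning

  %-cancelˡ-+ : ∀ z {x y} → (z + x) % n ≡ (z + y) % n → x % n ≡ y % n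
  %-cancelˡ-+ z {x} {y} eq = begin
    x % n                       ≡⟨ [m+kn]%n≡m%n x z n ⟨
    (x + z * n) % n             ≡⟨ cong (_% n) (complement x) ⟩
    (z * pred n + (z + x)) % n  ≡⟨ %-cong-+ {x = z * pred n} refl eq ⟩
    (z * pred n + (z + y)) % n  ≡⟨ cong (_% n) (complement y) ⟨
    (y + z * n) % n             ≡⟨ [m+kn]%n≡m%n y z n ⟩
    y % n                       ∎
    where
    open ≡-Reasoning
    rearrange : ∀ x z p → x + z * suc p ≡ z * p + (z + x)
    rearrange = solve-∀
    complement : ∀ x → x + z * n ≡ z * pred n + (z + x)
    complement x = trans (cong (λ t → x + z * t) (sym (suc-pred n))) (rearrange x z (pred n))

  %-cancelʳ-+ : ∀ z {x y} → (x + z) % n ≡ (y + z) % n → x % n ≡ y % n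
  %-cancelʳ-+ z {x} {y} eq =
    %-cancelˡ-+ z (trans (cong (_% n) (+-comm z x)) (trans eq (cong (_% n) (+-comm y z))))

  %-injective-< : ∀ {x y} → x < n → y < n → x % n ≡ y % n → x ≡ y
  %-injective-< x<n y<n eq = trans (sym (m<n⇒m%n≡m x<n)) (trans eq (m<n⇒m%n≡m y<n))

  m<n+n⇒m≡m%n⊎m≡m%n+n : ∀ {x} → x < n + n → x ≡ x % n ⊎ x ≡ x % n + n
  m<n+n⇒m≡m%n⊎m≡m%n+n {x} x<n+n with x <? n
  ... | yes x<n = inj₁ (sym (m<n⇒m%n≡m x<n))
  ... | no x≮n  = inj₂ (begin
    x          ≡⟨ m∸n+n≡m n≤x ⟨
    x ∸ n + n  ≡⟨ cong (_+ n) x∸n≡x%n ⟩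
    x % n + n  ∎)
    where
    open ≡-Reasoning
    n≤x : n ≤ x
    n≤x = ≮⇒≥ x≮n
    x∸n≡x%n : x ∸ n ≡ x % n
    x∸n≡x%n = trans (sym (m<n⇒m%n≡m (m<n+o⇒m∸n<o x n x<n+n))) (m≤n⇒[n∸m]%m≡n%m n≤x)

module _ (m k : ℕ) .{{_ : NonZero m}} .{{_ : NonZero k}} where

  private instance
    mk≢0 : NonZero (m * k)
    mk≢0 = m*n≢0 m k

  %-*-scale : ∀ {x y} → x % m ≡ y % m → (x * k) % (m * k) ≡ (y * k) % (m * k)
  %-*-scale {x} {y} eq =
    trans (sym (m%n*o≡m*o%[n*o] x m k)) (trans (cong (_* k) eq) (m%n*o≡m*o%[n*o] y m k))

  %-*-unscale : ∀ {x y} → (x * k) % (m * k) ≡ (y * k) % (m * k) → x % m ≡ y % m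
  %-*-unscale {x} {y} eq = *-cancelʳ-≡ (x % m) (y % m) k
    (trans (m%n*o≡m*o%[n*o] x m k) (trans eq (sym (m%n*o≡m*o%[n*o] y m k))))

  %-mod-factor : ∀ {x y} → x % (m * k) ≡ y % (m * k) → x % k ≡ y % k
  %-mod-factor {x} {y} eq = begin
    x % k            ≡⟨ m∣n⇒o%n%m≡o%m k (m * k) x (n∣m*n m) ⟨
    x % (m * k) % k  ≡⟨ cong (_% k) eq ⟩
    y % (m * k) % k  ≡⟨ m∣n⇒o%n%m≡o%m k (m * k) y (n∣m*n m) ⟩
    y % k            ∎
    where open ≡-Reasoning

module _ {n : ℕ} .{{_ : NonZero n}} where

  rotate : ℕ → Fin n → Fin n
  rotate t i = (t + toℕ i) mod n

  toℕ-rotate : ∀ t i → toℕ (rotate t i) ≡ (t + toℕ i) % n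
  toℕ-rotate t i = toℕ-fromℕ< _

  rotate-+ : ∀ t u i → rotate t (rotate u i) ≡ rotate (t + u) i
  rotate-+ t u i = toℕ-injective (begin
    toℕ (rotate t (rotate u i))  ≡⟨ toℕ-rotate t _ ⟩
    (t + toℕ (rotate u i)) % n   ≡⟨ %-cong-+ n refl (trans (cong (_% n) (toℕ-rotate u i)) (m%n%n≡m%n _ n)) ⟩
    (t + (u + toℕ i)) % n        ≡⟨ cong (_% n) (+-assoc t u (toℕ i)) ⟨
    (t + u + toℕ i) % n          ≡⟨ toℕ-rotate (t + u) i ⟨
    toℕ (rotate (t + u) i)       ∎)
    where open ≡-Reasoning

  rotate-multiple : ∀ q i → rotate (q * n) i ≡ i
  rotate-multiple q i = toℕ-injective (begin
    toℕ (rotate (q * n) i)  ≡⟨ toℕ-rotate (q * n) i ⟩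
    (q * n + toℕ i) % n     ≡⟨ cong (_% n) (+-comm (q * n) (toℕ i)) ⟩
    (toℕ i + q * n) % n     ≡⟨ [m+kn]%n≡m%n (toℕ i) q n ⟩
    toℕ i % n               ≡⟨ m<n⇒m%n≡m (toℕ<n i) ⟩
    toℕ i                   ∎)
    where open ≡-Reasoning

  rotation : ℕ → Permutation′ n
  rotation t = permutation (rotate t) (rotate (t * pred n)) undo redo
    where
    t+t*pred[n]≡t*n : t + t * pred n ≡ t * n
    t+t*pred[n]≡t*n = trans (sym (*-suc t (pred n))) (cong (t *_) (suc-pred n))
    undo : ∀ i → rotate t (rotate (t * pred n) i) ≡ i
    undo i = trans (rotate-+ t _ i) (trans (cong (λ u → rotate u i) t+t*pred[n]≡t*n) (rotate-multiple t i))
    redo : ∀ i → rotate (t * pred n) (rotate t i) ≡ i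
    redo i = trans (rotate-+ _ t i)
      (trans (cong (λ u → rotate u i) (trans (+-comm (t * pred n) t) t+t*pred[n]≡t*n)) (rotate-multiple t i))

  infixl 6 _⊖_
  _⊖_ : Fin n → Fin n → Fin n
  l ⊖ i = rotation (toℕ i) ⟨$⟩ˡ l

  rotate-⊖ : ∀ i l → rotate (toℕ i) (l ⊖ i) ≡ l
  rotate-⊖ i l = inverseʳ (rotation (toℕ i))

  rotate≡⇒≡⊖ : ∀ {i j l} → rotate (toℕ i) j ≡ l → j ≡ l ⊖ i
  rotate≡⇒≡⊖ {i} refl = sym (inverseˡ (rotation (toℕ i)))

-- The selector in the product of twistRaw: whether u^i u^j contributes to u^l.
landsOn : ∀ {n} → Fin n → Fin n → Fin n → Bool
landsOn {n} i j l = does (toℕ i ℕ.+ toℕ j ℕ.≟ toℕ l) ∨ does (toℕ i ℕ.+ toℕ j ℕ.≟ toℕ l ℕ.+ n)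

module _ {n : ℕ} .{{_ : NonZero n}} where

  landsOn⇒≡⊖ : ∀ {i j l : Fin n} → T (landsOn i j l) → j ≡ l ⊖ i
  landsOn⇒≡⊖ {i} {j} {l} hit =
    rotate≡⇒≡⊖ (toℕ-injective (trans (toℕ-rotate (toℕ i) j) (reduce (Equivalence.to T-∨ hit))))
    where
    reduce : T (does (toℕ i + toℕ j ℕ.≟ toℕ l)) ⊎ T (does (toℕ i + toℕ j ℕ.≟ toℕ l + n)) →
             (toℕ i + toℕ j) % n ≡ toℕ l
    reduce (inj₁ p) = trans (cong (_% n) (≡ᵇ⇒≡ _ _ p)) (m<n⇒m%n≡m (toℕ<n l))
    reduce (inj₂ p) = trans (cong (_% n) (≡ᵇ⇒≡ _ _ p)) (trans ([m+n]%n≡m%n (toℕ l) n) (m<n⇒m%n≡m (toℕ<n l)))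

  landsOn-⊖ : ∀ (i l : Fin n) → T (landsOn i (l ⊖ i) l)
  landsOn-⊖ i l = Equivalence.from T-∨ (witness (m<n+n⇒m≡m%n⊎m≡m%n+n n (+-mono-< (toℕ<n i) (toℕ<n (l ⊖ i)))))
    where
    s : ℕ
    s = toℕ i + toℕ (l ⊖ i)
    s%n≡l : s % n ≡ toℕ l
    s%n≡l = trans (sym (toℕ-rotate (toℕ i) (l ⊖ i))) (cong toℕ (rotate-⊖ i l))
    witness : s ≡ s % n ⊎ s ≡ s % n + n → T (does (s ℕ.≟ toℕ l)) ⊎ T (does (s ℕ.≟ toℕ l + n))
    witness (inj₁ p) = inj₁ (≡⇒≡ᵇ _ _ (trans p s%n≡l))
    witness (inj₂ p) = inj₂ (≡⇒≡ᵇ _ _ (trans p (cong (_+ n) s%n≡l)))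

module Degree (M K : ℕ) .{{_ : NonZero M}} .{{_ : NonZero K}} where

  N : ℕ
  N = M * K

  instance
    N≢0 : NonZero N
    N≢0 = m*n≢0 M K

  flip-opposite : (Fin K × Fin M) ↔ (Fin M × Fin K)
  flip-opposite = mk↔ₛ′ (λ (c , s) → s , opposite c) (λ (s , c) → opposite c , s)
    (λ (s , c) → cong (s ,_) (opposite-involutive c)) (λ (c , s) → cong (_, s) (opposite-involutive c))

  -- combine s (opposite c) is K s + (K - 1 - c), so the rotation by
  -- 1 + a + (M - 1) K turns it into the residue of a - c + s K.
  degree : Fin K → (Fin K × Fin M) ↔ Fin N
  degree a = rotation (suc (toℕ a) + pred M * K) ↔-∘ (↔-sym *↔× ↔-∘ flip-opposite)

  deg : Fin K → Fin K → Fin M → Fin N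
  deg a c s = Inverse.to (degree a) (c , s)

  deg-spec : ∀ a c s → (toℕ (deg a c s) + toℕ c) % N ≡ (toℕ a + toℕ s * K) % N
  deg-spec a c s = begin
    (toℕ (deg a c s) + toℕ c) % N  ≡⟨ %-cong-+ N (trans (cong (_% N) toℕ-deg) (m%n%n≡m%n _ N)) refl ⟩
    (t + (K * toℕ s + (K ∸ suc (toℕ c))) + toℕ c) % N
                                   ≡⟨ cong (_% N) unfold ⟩
    (toℕ a + toℕ s * K + N) % N    ≡⟨ [m+n]%n≡m%n _ N ⟩
    (toℕ a + toℕ s * K) % N        ∎
    where
    open ≡-Reasoning
    t : ℕ
    t = suc (toℕ a) + pred M * K
    toℕ-deg : toℕ (deg a c s) ≡ (t + (K * toℕ s + (K ∸ suc (toℕ c)))) % N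
    toℕ-deg = trans (toℕ-rotate t (combine s (opposite c)))
      (cong (λ j → (t + j) % N) (trans (toℕ-combine s (opposite c)) (cong (K * toℕ s +_) (opposite-prop c))))
    rearrange : ∀ a p s K d c → suc a + p * K + (K * s + d) + c ≡ a + s * K + ((d + suc c) + p * K)
    rearrange = solve-∀
    unfold : t + (K * toℕ s + (K ∸ suc (toℕ c))) + toℕ c ≡ toℕ a + toℕ s * K + N
    unfold = begin
      t + (K * toℕ s + (K ∸ suc (toℕ c))) + toℕ c
        ≡⟨ rearrange (toℕ a) (pred M) (toℕ s) K (K ∸ suc (toℕ c)) (toℕ c) ⟩
      toℕ a + toℕ s * K + ((K ∸ suc (toℕ c) + suc (toℕ c)) + pred M * K)
        ≡⟨ cong (λ j → toℕ a + toℕ s * K + (j + pred M * K)) (m∸n+n≡m (toℕ<n c)) ⟩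
      toℕ a + toℕ s * K + suc (pred M) * K
        ≡⟨ cong (λ j → toℕ a + toℕ s * K + j * K) (suc-pred M) ⟩
      toℕ a + toℕ s * K + N ∎

  deg-unique : ∀ {x a c s} → x < N → (x + toℕ c) % N ≡ (toℕ a + toℕ s * K) % N → x ≡ toℕ (deg a c s)
  deg-unique {x} {a} {c} {s} x<N eq =
    %-injective-< N x<N (toℕ<n (deg a c s)) (%-cancelʳ-+ N (toℕ c) (trans eq (sym (deg-spec a c s))))

  deg≡0⇔ : ∀ {a b s} → toℕ (deg a b s) ≡ 0 ⇔ (toℕ a ≡ toℕ b × toℕ s ≡ 0)
  deg≡0⇔ {a} {b} {s} = mk⇔ to from
    where
    from : ∀ {b s} → toℕ a ≡ toℕ b × toℕ s ≡ 0 → toℕ (deg a b s) ≡ 0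
    from (a≡b , s≡0) with refl ← toℕ-injective a≡b = sym (deg-unique (>-nonZero⁻¹ N)
      (sym (trans (cong (λ j → (toℕ a + j * K) % N) s≡0) (cong (_% N) (+-identityʳ (toℕ a))))))
    s₀ : Fin M
    s₀ = 0 mod M
    toℕ-s₀ : toℕ s₀ ≡ 0
    toℕ-s₀ = trans (toℕ-fromℕ< _) (m<n⇒m%n≡m (>-nonZero⁻¹ M))
    to : toℕ (deg a b s) ≡ 0 → toℕ a ≡ toℕ b × toℕ s ≡ 0
    to eq with b≡a , s≡s₀ ← ,-injective (Injection.injective (↔⇒↣ (degree a))
                              (toℕ-injective (trans eq (sym (from (refl , toℕ-s₀))))))
      = cong toℕ (sym b≡a) , trans (cong toℕ s≡s₀) toℕ-s₀

  deg-⊖ : ∀ a b c s s₁ → deg a b s ⊖ deg a c s₁ ≡ deg c b (s ⊖ s₁)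
  deg-⊖ a b c s s₁ = sym (rotate≡⇒≡⊖ (toℕ-injective (deg-unique (toℕ<n _) (begin
    (toℕ (rotate d₁ (deg c b s₂)) + toℕ b) % N
      ≡⟨ %-cong-+ N (trans (cong (_% N) (toℕ-rotate d₁ (deg c b s₂))) (m%n%n≡m%n _ N)) refl ⟩
    (d₁ + toℕ (deg c b s₂) + toℕ b) % N
      ≡⟨ cong (_% N) (+-assoc d₁ _ (toℕ b)) ⟩
    (d₁ + (toℕ (deg c b s₂) + toℕ b)) % N
      ≡⟨ %-cong-+ N {x = d₁} refl (deg-spec c b s₂) ⟩
    (d₁ + (toℕ c + toℕ s₂ * K)) % N
      ≡⟨ cong (_% N) (+-assoc d₁ (toℕ c) _) ⟨
    (d₁ + toℕ c + toℕ s₂ * K) % N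
      ≡⟨ %-cong-+ N (deg-spec a c s₁) refl ⟩
    (toℕ a + toℕ s₁ * K + toℕ s₂ * K) % N
      ≡⟨ cong (_% N) (trans (+-assoc (toℕ a) _ _)
                            (cong (toℕ a +_) (sym (*-distribʳ-+ K (toℕ s₁) (toℕ s₂))))) ⟩
    (toℕ a + (toℕ s₁ + toℕ s₂) * K) % N
      ≡⟨ %-cong-+ N refl (%-*-scale M K s₁+s₂≡s) ⟩
    (toℕ a + toℕ s * K) % N ∎))))
    where
    open ≡-Reasoning
    d₁ : ℕ
    d₁ = toℕ (deg a c s₁)
    s₂ : Fin M
    s₂ = s ⊖ s₁
    s₁+s₂≡s : (toℕ s₁ + toℕ s₂) % M ≡ toℕ s % M
    s₁+s₂≡s = trans (sym (toℕ-rotate (toℕ s₁) s₂))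
                    (trans (cong toℕ (rotate-⊖ s₁ s)) (sym (m<n⇒m%n≡m (toℕ<n s))))

  deg-quotient : ∀ a c s → ∃ λ q → toℕ (deg a c s) + toℕ c ≡ toℕ a + q * K × q % M ≡ toℕ s
  deg-quotient a c s = q , d+c≡a+qK , q%M≡s
    where
    d+c : ℕ
    d+c = toℕ (deg a c s) + toℕ c
    q : ℕ
    q = d+c / K
    d+c%K≡a : d+c % K ≡ toℕ a
    d+c%K≡a = trans (%-mod-factor M K (deg-spec a c s))
                    (trans ([m+kn]%n≡m%n (toℕ a) (toℕ s) K) (m<n⇒m%n≡m (toℕ<n a)))
    d+c≡a+qK : d+c ≡ toℕ a + q * K
    d+c≡a+qK = trans (m≡m%n+[m/n]*n d+c K) (cong (_+ q * K) d+c%K≡a)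
    q%M≡s : q % M ≡ toℕ s
    q%M≡s = trans (%-*-unscale M K (%-cancelˡ-+ N (toℕ a) (trans (cong (_% N) (sym d+c≡a+qK)) (deg-spec a c s))))
                  (m<n⇒m%n≡m (toℕ<n s))

if-T : ∀ {a} {A : Set a} {b} {x y : A} → T b → (if b then x else y) ≡ x
if-T {b = true} _ = refl

if-¬T : ∀ {a} {A : Set a} {b} {x y : A} → ¬ T b → (if b then x else y) ≡ y
if-¬T {b = true}  ¬t = contradiction _ ¬t
if-¬T {b = false} _  = refl

module FiniteSums {c ℓ} (E : QAlgebra c ℓ) where

  open QAlgebra E using (Carrier; _≈_; 0#; isRing) renaming (_+_ to _+ᴱ_; _*_ to _*ᴱ_)
  private module R = IsRing isRing
  open import Relation.Binary.Reasoning.Setoid R.setoid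

  ring : Ring c ℓ
  ring = record { QAlgebra E }

  open SemiringSum (Ring.semiring ring) public
    using (sum; sum-syntax; sum-cong-≋; sum-cong-≗; sum-permute; sum-remove; sum-replicate-zero)

  sumR≡sum : ∀ {n} (v : Fin n → Carrier) → sumR (raw E) v ≡ sum v
  sumR≡sum {zero}  v = refl
  sumR≡sum {suc n} v = cong (v zero +ᴱ_) (sumR≡sum (v ∘ suc))

  sumR-pow : ∀ {n k} (v : Fin n → Fin k → Carrier) a → sumR (powRaw (raw E) k) v a ≡ ∑[ i < n ] v i a
  sumR-pow {zero}  v a = refl
  sumR-pow {suc n} v a = cong (v zero a +ᴱ_) (sumR-pow (v ∘ suc) a)

  sumR-twist : ∀ {n k φ} (v : Fin n → Fin k → Carrier) a → sumR (twistRaw (raw E) k φ) v a ≡ ∑[ i < n ] v i a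
  sumR-twist {zero}  v a = refl
  sumR-twist {suc n} v a = cong (v zero a +ᴱ_) (sumR-twist (v ∘ suc) a)

  sum-single : ∀ {n} (v : Fin n → Carrier) i → (∀ j → j ≢ i → v j ≈ 0#) → sum v ≈ v i
  sum-single {suc n} v i vanish = begin
    sum v                       ≈⟨ sum-remove v ⟩
    v i +ᴱ sum (v ∘ punchIn i)  ≈⟨ R.+-congˡ (R.trans (sum-cong-≋ (λ j → vanish (punchIn i j) (punchInᵢ≢i i j)))
                                                       (sum-replicate-zero n)) ⟩
    v i +ᴱ 0#                   ≈⟨ R.+-identityʳ (v i) ⟩
    v i                         ∎

  sum-landsOn : ∀ {n} .{{_ : NonZero n}} (i l : Fin n) (h : Fin n → Carrier) →
                ∑[ j < n ] (if landsOn i j l then h j else 0#) ≈ h (l ⊖ i)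
  sum-landsOn i l h = R.trans (sum-single _ (l ⊖ i) miss) (R.reflexive (if-T (landsOn-⊖ i l)))
    where
    miss : ∀ j → j ≢ l ⊖ i → (if landsOn i j l then h j else 0#) ≈ 0#
    miss j j≢l⊖i = R.reflexive (if-¬T (j≢l⊖i ∘ landsOn⇒≡⊖ {i = i} {j} {l}))

  twist-*-coeff : ∀ {n} .{{_ : NonZero n}} (φ : Carrier → Carrier) (x y : Fin n → Carrier) l →
                  RawQAlg._*_ (twistRaw (raw E) n φ) x y l ≈ ∑[ i < n ] (x i *ᴱ iter (toℕ i) φ (y (l ⊖ i)))
  twist-*-coeff {n} φ x y l = begin
    RawQAlg._*_ (twistRaw (raw E) n φ) x y l
      ≡⟨ trans (sumR≡sum (λ i → sumR (raw E) (term i))) (sum-cong-≗ (λ i → sumR≡sum (term i))) ⟩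
    ∑[ i < n ] ∑[ j < n ] term i j
      ≈⟨ sum-cong-≋ (λ i → sum-landsOn i l (λ j → x i *ᴱ iter (toℕ i) φ (y j))) ⟩
    ∑[ i < n ] (x i *ᴱ iter (toℕ i) φ (y (l ⊖ i))) ∎
    where
    term : Fin n → Fin n → Carrier
    term i j = if landsOn i j l then x i *ᴱ iter (toℕ i) φ (y j) else 0#

  twistPow-*-coeff : ∀ {n k} .{{_ : NonZero n}} (Φ : (Fin k → Carrier) → Fin k → Carrier)
                     (X Y : Fin n → Fin k → Carrier) l a →
                     RawQAlg._*_ (twistRaw (powRaw (raw E) k) n Φ) X Y l a
                       ≈ ∑[ i < n ] (X i a *ᴱ iter (toℕ i) Φ (Y (l ⊖ i)) a)
  twistPow-*-coeff {n} {k} Φ X Y l a = begin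
    RawQAlg._*_ (twistRaw (powRaw (raw E) k) n Φ) X Y l a
      ≡⟨ trans (sumR-pow (λ i → sumR (powRaw (raw E) k) (term i)) a)
               (sum-cong-≗ (λ i → trans (sumR-pow (term i) a) (sum-cong-≗ (term-at i)))) ⟩
    ∑[ i < n ] ∑[ j < n ] (if landsOn i j l then X i a *ᴱ iter (toℕ i) Φ (Y j) a else 0#)
      ≈⟨ sum-cong-≋ (λ i → sum-landsOn i l (λ j → X i a *ᴱ iter (toℕ i) Φ (Y j) a)) ⟩
    ∑[ i < n ] (X i a *ᴱ iter (toℕ i) Φ (Y (l ⊖ i)) a) ∎
    where
    term : Fin n → Fin n → Fin k → Carrier
    term i j = if landsOn i j l then (λ b → X i b *ᴱ iter (toℕ i) Φ (Y j) b) else (λ _ → 0#)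
    term-at : ∀ i j → term i j a ≡ (if landsOn i j l then X i a *ᴱ iter (toℕ i) Φ (Y j) a else 0#)
    term-at i j = if-float (λ (g : Fin k → Carrier) → g a) (landsOn i j l)

  sum-↑ : ∀ m {n} (f : Fin (m + n) → Carrier) → sum f ≈ sum (f ∘ (_↑ˡ n)) +ᴱ sum (f ∘ (m ↑ʳ_))
  sum-↑ zero    f = R.sym (R.+-identityˡ _)
  sum-↑ (suc m) f = R.trans (R.+-congˡ (sum-↑ m (f ∘ suc))) (R.sym (R.+-assoc _ _ _))

  sum-combine : ∀ m {n} (f : Fin (m * n) → Carrier) → sum f ≈ ∑[ i < m ] ∑[ j < n ] f (combine i j)
  sum-combine zero        f = R.refl
  sum-combine (suc m) {n} f = R.trans (sum-↑ n f) (R.+-congˡ (sum-combine m (f ∘ (n ↑ʳ_))))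

  sum-reindex : ∀ {m n p} (π : (Fin m × Fin n) ↔ Fin p) (f : Fin p → Carrier) →
                sum f ≈ ∑[ i < m ] ∑[ j < n ] f (Inverse.to π (i , j))
  sum-reindex {m} {n} π f = begin
    sum f
      ≈⟨ sum-permute f (π ↔-∘ *↔×) ⟩
    sum (f ∘ Inverse.to π ∘ remQuot n)
      ≈⟨ sum-combine m _ ⟩
    ∑[ i < m ] ∑[ j < n ] f (Inverse.to π (remQuot n (combine i j)))
      ≡⟨ sum-cong-≗ (λ i → sum-cong-≗ (λ j → cong (f ∘ Inverse.to π) (remQuot-combine i j))) ⟩
    ∑[ i < m ] ∑[ j < n ] f (Inverse.to π (i , j)) ∎

iter-+ : ∀ {a} {A : Set a} (f : A → A) m n x → iter (m + n) f x ≡ iter m f (iter n f x)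
iter-+ f zero    n x = refl
iter-+ f (suc m) n x = cong f (iter-+ f m n x)

iter-cycShift : ∀ {a} {A : Set a} (σ : A → A) {k} (Z : Fin k → A) i q (b c : Fin k) →
                i + toℕ c ≡ toℕ b + q * k → iter i (cycShift σ k) Z b ≡ iter q σ (Z c)
iter-cycShift σ Z zero zero b c eq = cong Z (toℕ-injective (sym (trans eq (+-identityʳ (toℕ b)))))
iter-cycShift σ {k} Z zero (suc q) b c eq =
  contradiction eq (<⇒≢ (<-≤-trans (toℕ<n c) (≤-trans (m≤m+n k (q * k)) (m≤n+m _ (toℕ b)))))
iter-cycShift σ Z (suc i) zero zero c ()
iter-cycShift σ {suc k} Z (suc i) (suc q) zero c eq =
  cong σ (iter-cycShift σ Z i q (fromℕ k) c (trans (suc-injective eq) (cong (_+ q * suc k) (sym (toℕ-fromℕ k)))))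
iter-cycShift σ {suc k} Z (suc i) q (suc b) c eq =
  iter-cycShift σ Z i q (inject₁ b) c (trans (suc-injective eq) (cong (_+ q * suc k) (sym (toℕ-inject₁ b))))

module PeriodicIteration {c ℓ} {E : QAlgebra c ℓ} (σ : Automorphism E) (M : ℕ) .{{_ : NonZero M}}
  (periodic : ∀ x → QAlgebra._≈_ E (iter M (Automorphism.to σ) x) x) where

  open QAlgebra E using (_≈_; isRing)
  private module R = IsRing isRing
  open Automorphism σ using (to; to-cong)

  iter-cong : ∀ n {x y} → x ≈ y → iter n to x ≈ iter n to y
  iter-cong zero    x≈y = x≈y
  iter-cong (suc n) x≈y = to-cong (iter-cong n x≈y)

  iter-multiple : ∀ q x → iter (q * M) to x ≈ x
  iter-multiple zero    x = R.refl
  iter-multiple (suc q) x =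
    R.trans (R.reflexive (iter-+ to M (q * M) x)) (R.trans (periodic _) (iter-multiple q x))

  iter-% : ∀ w x → iter w to x ≈ iter (w % M) to x
  iter-% w x = R.trans
    (R.reflexive (trans (cong (λ v → iter v to x) (m≡m%n+[m/n]*n w M)) (iter-+ to (w % M) _ x)))
    (iter-cong (w % M) (iter-multiple (w / M) x))

module TwistedMatrixIso {c ℓ} (E : QAlgebra c ℓ) (σ : Automorphism E) (M K : ℕ) .{{_ : NonZero M}}
  .{{_ : NonZero K}} (periodic : ∀ x → QAlgebra._≈_ E (iter M (Automorphism.to σ) x) x) where

  open QAlgebra E using (Carrier; _≈_; 0#; 1#; isRing) renaming (_*_ to _*ᴱ_)
  private module R = IsRing isRing
  open import Relation.Binary.Reasoning.Setoid R.setoid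
  open FiniteSums E
  open Degree M K
  open PeriodicIteration σ M periodic

  τ : Carrier → Carrier
  τ = Automorphism.to σ

  f : (Fin K → Carrier) → Fin K → Carrier
  f = cycShift τ K

  Twisted : RawQAlg c ℓ
  Twisted = twistRaw (powRaw (raw E) K) N f

  Matrices : RawQAlg c ℓ
  Matrices = matRaw (twistRaw (raw E) M τ) K

  iter-f-deg : ∀ a c s (Z : Fin K → Carrier) → iter (toℕ (deg a c s)) f Z a ≈ iter (toℕ s) τ (Z c)
  iter-f-deg a c s Z with q , d+c≡a+qK , q%M≡s ← deg-quotient a c s = R.trans
    (R.reflexive (iter-cycShift τ Z (toℕ (deg a c s)) q a c d+c≡a+qK))
    (R.trans (iter-% q (Z c)) (R.reflexive (cong (λ t → iter t τ (Z c)) q%M≡s)))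

  toMatrix : RawQAlg.Carrier Twisted → RawQAlg.Carrier Matrices
  toMatrix X a c s = X (deg a c s) a

  fromMatrix : RawQAlg.Carrier Matrices → RawQAlg.Carrier Twisted
  fromMatrix A i a = uncurry (A a) (Inverse.from (degree a) i)

  toMatrix-* : ∀ X Y a b s →
               toMatrix (RawQAlg._*_ Twisted X Y) a b s ≈ RawQAlg._*_ Matrices (toMatrix X) (toMatrix Y) a b s
  toMatrix-* X Y a b s = begin
    RawQAlg._*_ Twisted X Y (deg a b s) a
      ≈⟨ twistPow-*-coeff f X Y (deg a b s) a ⟩
    ∑[ i < N ] (X i a *ᴱ iter (toℕ i) f (Y (deg a b s ⊖ i)) a)
      ≈⟨ sum-reindex (degree a) _ ⟩
    ∑[ c < K ] ∑[ s₁ < M ] (X (deg a c s₁) a *ᴱ iter (toℕ (deg a c s₁)) f (Y (deg a b s ⊖ deg a c s₁)) a)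
      ≈⟨ sum-cong-≋ (λ c → sum-cong-≋ (λ s₁ → R.*-congˡ (shift c s₁))) ⟩
    ∑[ c < K ] ∑[ s₁ < M ] (X (deg a c s₁) a *ᴱ iter (toℕ s₁) τ (Y (deg c b (s ⊖ s₁)) c))
      ≈⟨ sum-cong-≋ (λ c → twist-*-coeff τ (toMatrix X a c) (toMatrix Y c b) s) ⟨
    ∑[ c < K ] RawQAlg._*_ (twistRaw (raw E) M τ) (toMatrix X a c) (toMatrix Y c b) s
      ≡⟨ sumR-twist (λ c → RawQAlg._*_ (twistRaw (raw E) M τ) (toMatrix X a c) (toMatrix Y c b)) s ⟨
    RawQAlg._*_ Matrices (toMatrix X) (toMatrix Y) a b s ∎
    where
    shift : ∀ c s₁ → iter (toℕ (deg a c s₁)) f (Y (deg a b s ⊖ deg a c s₁)) a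
                       ≈ iter (toℕ s₁) τ (Y (deg c b (s ⊖ s₁)) c)
    shift c s₁ = R.trans (R.reflexive (cong (λ j → iter (toℕ (deg a c s₁)) f (Y j) a) (deg-⊖ a b c s s₁)))
                         (iter-f-deg a c s₁ (Y (deg c b (s ⊖ s₁))))

  toMatrix-1 : ∀ a b s → toMatrix (RawQAlg.1# Twisted) a b s ≈ RawQAlg.1# Matrices a b s
  toMatrix-1 a b s = begin
    (if does (toℕ (deg a b s) ℕ.≟ 0) then (λ _ → 1#) else (λ _ → 0#)) a
      ≡⟨ if-float (λ (g : Fin K → Carrier) → g a) (does (toℕ (deg a b s) ℕ.≟ 0)) ⟩
    (if does (toℕ (deg a b s) ℕ.≟ 0) then 1# else 0#)
      ≡⟨ cong (if_then 1# else 0#)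
              (does-⇔ deg≡0⇔ (toℕ (deg a b s) ℕ.≟ 0) (toℕ a ℕ.≟ toℕ b ×-dec toℕ s ℕ.≟ 0)) ⟩
    (if does (toℕ a ℕ.≟ toℕ b) ∧ does (toℕ s ℕ.≟ 0) then 1# else 0#)
      ≡⟨ if-∧ (does (toℕ a ℕ.≟ toℕ b)) ⟩
    (if does (toℕ a ℕ.≟ toℕ b) then (if does (toℕ s ℕ.≟ 0) then 1# else 0#) else 0#)
      ≡⟨ if-float (λ (g : Fin M → Carrier) → g s) (does (toℕ a ℕ.≟ toℕ b)) ⟨
    RawQAlg.1# Matrices a b s ∎

  iso : Twisted ≃Alg Matrices
  iso = record
    { to        = toMatrix
    ; from      = fromMatrix
    ; to-cong   = λ X≈Y a c s → X≈Y (deg a c s) a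
    ; from-cong = λ A≈B i a → A≈B a _ _
    ; to-from   = λ A a c s → R.reflexive (cong (uncurry (A a)) (Inverse.strictlyInverseʳ (degree a) (c , s)))
    ; from-to   = λ X i a → R.reflexive (cong (λ j → X j a) (Inverse.strictlyInverseˡ (degree a) i))
    ; to-+      = λ _ _ _ _ _ → R.refl
    ; to-*      = toMatrix-*
    ; to-1      = toMatrix-1
    ; to-·      = λ _ _ _ _ _ → R.refl
    }

mainTheorem20 : ∀ {c ℓ p} (E : QAlgebra c ℓ) → FiniteDimensional E → IsSimple E p →
    (m k : ℕ) → 1 ≤ m → 1 ≤ k →
    (σ : Automorphism E) →
    (∀ x → QAlgebra._≈_ E (iter m (Automorphism.to σ) x) x) →
    twistRaw (powRaw (raw E) k) (m * k) (cycShift (Automorphism.to σ) k)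
    ≃Alg matRaw (twistRaw (raw E) m (Automorphism.to σ)) k
mainTheorem20 E _ _ m k 1≤m 1≤k σ periodic =
  TwistedMatrixIso.iso E σ m k {{>-nonZero 1≤m}} {{>-nonZero 1≤k}} periodic
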